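{- Let $n \ge 1$ and let $i$ be an integer with $1 \le i < 3^n$. Then $\binom{3i}{i-1} \not\equiv 0 \pmod 3$ if and only if $i = (3^k - 1)/2$ for some $k \in \{1, 2, \dots, n\}$. -}

-- By Lucas' theorem for p = 3, a binomial coefficient is congruent mod 3 to the product of the
-- binomials of its base-3 digits. The last digit of 3i is 0, so C(3i, i - 1) vanishes mod 3 unless
-- i - 1 = 3q, in which case it is congruent to C(3q + 1, q). Peeling digits off q: a last digit 2
-- gives 0, a last digit 1 leads to the same coefficient for q / 3, and a last digit 0 (q > 0)
-- leads to C(3a, a), which vanishes mod 3 by the same digit argument. Hence the residue is nonzero
-- exactly when every base-3 digit of q is 1, i.e. when i = 1 + 3q = (3^k - 1)/2.
module Submission where

open import Data.Nat using (ℕ; zero; suc; _+_; _*_; _∸_; _^_; _≤_; _<_; _/_; _%_; z≤n; s≤s; z<s; s<s; NonZero)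
open import Data.Nat.Combinatorics using (_C_; nCk+nC[k+1]≡[n+1]C[k+1]; k>n⇒nCk≡0; nC1≡n)
open import Data.Nat.DivMod using (%-distribˡ-+; [m+n]%n≡m%n; [m+kn]%n≡m%n; m*n/n≡m)
open import Data.Nat.Properties
open import Data.Nat.Tactic.RingSolver using (solve-∀)
open import Data.Product using (Σ; _×_; _,_)
open import Data.Sum using (_⊎_; inj₁; inj₂)
open import Function.Bundles using (_⇔_; mk⇔)
open import Relation.Binary.PropositionalEquality
open import Relation.Nullary using (¬_; yes; no; contradiction)

infix 4 _≡_[mod_]
_≡_[mod_] : ℕ → ℕ → (d : ℕ) → .{{NonZero d}} → Set
m ≡ n [mod d ] = m % d ≡ n % d

^-cancelʳ-< : ∀ b .{{_ : NonZero b}} {m n} → b ^ m < b ^ n → m < n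
^-cancelʳ-< b {m} {n} bᵐ<bⁿ with m <? n
... | yes m<n = m<n
... | no m≮n = contradiction (^-monoʳ-≤ b (≮⇒≥ m≮n)) (<⇒≱ bᵐ<bⁿ)

[2+n]C[2+k]≡nCk+2nC[1+k]+nC[2+k] : ∀ n k →
  (2 + n) C (2 + k) ≡ n C k + 2 * (n C (1 + k)) + n C (2 + k)
[2+n]C[2+k]≡nCk+2nC[1+k]+nC[2+k] n k = begin
  (2 + n) C (2 + k)                                   ≡⟨ nCk+nC[k+1]≡[n+1]C[k+1] (1 + n) (1 + k) ⟨
  (1 + n) C (1 + k) + (1 + n) C (2 + k)               ≡⟨ cong₂ _+_ (nCk+nC[k+1]≡[n+1]C[k+1] n k)
                                                                   (nCk+nC[k+1]≡[n+1]C[k+1] n (1 + k)) ⟨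
  (n C k + n C (1 + k)) + (n C (1 + k) + n C (2 + k)) ≡⟨ regroup (n C k) (n C (1 + k)) (n C (2 + k)) ⟩
  n C k + 2 * (n C (1 + k)) + n C (2 + k)             ∎
  where
  open ≡-Reasoning
  regroup : ∀ a b c → (a + b) + (b + c) ≡ a + 2 * b + c
  regroup = solve-∀

-- The coefficientwise form of (1 + x)³ ≡ 1 + x³ (mod 3).
[3+n]C[3+k]≡nCk+nC[3+k][mod3] : ∀ n k → (3 + n) C (3 + k) ≡ n C k + n C (3 + k) [mod 3 ]
[3+n]C[3+k]≡nCk+nC[3+k][mod3] n k = begin
  ((3 + n) C (3 + k)) % 3           ≡⟨ cong (_% 3) expand ⟩
  (a + d + (b + c) * 3) % 3         ≡⟨ [m+kn]%n≡m%n (a + d) (b + c) 3 ⟩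
  (a + d) % 3                       ∎
  where
  open ≡-Reasoning
  a = n C k; b = n C (1 + k); c = n C (2 + k); d = n C (3 + k)
  regroup : ∀ a b c d → (a + 2 * b + c) + (b + 2 * c + d) ≡ a + d + (b + c) * 3
  regroup = solve-∀
  expand : (3 + n) C (3 + k) ≡ a + d + (b + c) * 3
  expand = begin
    (3 + n) C (3 + k)                     ≡⟨ nCk+nC[k+1]≡[n+1]C[k+1] (2 + n) (2 + k) ⟨
    (2 + n) C (2 + k) + (2 + n) C (3 + k) ≡⟨ cong₂ _+_ ([2+n]C[2+k]≡nCk+2nC[1+k]+nC[2+k] n k)
                                                       ([2+n]C[2+k]≡nCk+2nC[1+k]+nC[2+k] n (1 + k)) ⟩
    (a + 2 * b + c) + (b + 2 * c + d)     ≡⟨ regroup a b c d ⟩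
    a + d + (b + c) * 3                   ∎

[3+n]Cs≡nCs[mod3] : ∀ n s → s < 3 → (3 + n) C s ≡ n C s [mod 3 ]
[3+n]Cs≡nCs[mod3] n 0 _ = refl
[3+n]Cs≡nCs[mod3] n 1 _ = begin
  ((3 + n) C 1) % 3 ≡⟨ cong (_% 3) (trans (nC1≡n (3 + n)) (+-comm 3 n)) ⟩
  (n + 3) % 3       ≡⟨ [m+n]%n≡m%n n 3 ⟩
  n % 3             ≡⟨ cong (_% 3) (nC1≡n n) ⟨
  (n C 1) % 3       ∎
  where open ≡-Reasoning
[3+n]Cs≡nCs[mod3] n 2 _ = begin
  ((3 + n) C 2) % 3           ≡⟨ cong (_% 3) expand ⟩
  (n C 2 + (1 + n) * 3) % 3   ≡⟨ [m+kn]%n≡m%n (n C 2) (1 + n) 3 ⟩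
  (n C 2) % 3                 ∎
  where
  open ≡-Reasoning
  regroup : ∀ n c → (2 + n) + (1 + 2 * n + c) ≡ c + (1 + n) * 3
  regroup = solve-∀
  expand : (3 + n) C 2 ≡ n C 2 + (1 + n) * 3
  expand = begin
    (3 + n) C 2                          ≡⟨ nCk+nC[k+1]≡[n+1]C[k+1] (2 + n) 1 ⟨
    (2 + n) C 1 + (2 + n) C 2            ≡⟨ cong₂ _+_ (nC1≡n (2 + n))
                                                      ([2+n]C[2+k]≡nCk+2nC[1+k]+nC[2+k] n 0) ⟩
    (2 + n) + (1 + 2 * (n C 1) + n C 2)  ≡⟨ cong (λ x → (2 + n) + (1 + 2 * x + n C 2)) (nC1≡n n) ⟩
    (2 + n) + (1 + 2 * n + n C 2)        ≡⟨ regroup n (n C 2) ⟩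
    n C 2 + (1 + n) * 3                  ∎
[3+n]Cs≡nCs[mod3] n (suc (suc (suc _))) (s<s (s<s (s<s ())))

r+3[1+m]≡3+[r+3m] : ∀ r m → r + 3 * suc m ≡ 3 + (r + 3 * m)
r+3[1+m]≡3+[r+3m] = solve-∀

lucas₃ : ∀ m k r s → r < 3 → s < 3 → (r + 3 * m) C (s + 3 * k) ≡ (m C k) * (r C s) [mod 3 ]
lucas₃ zero zero r s _ _ =
  cong (_% 3) (trans (cong₂ _C_ (+-identityʳ r) (+-identityʳ s)) (sym (*-identityˡ (r C s))))
lucas₃ zero (suc k) r s r<3 _ = cong (_% 3) (k>n⇒nCk≡0 (begin-strict
  r + 0         ≡⟨ +-identityʳ r ⟩
  r             <⟨ r<3 ⟩
  3             ≤⟨ m≤m*n 3 (suc k) ⟩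
  3 * suc k     ≤⟨ m≤n+m (3 * suc k) s ⟩
  s + 3 * suc k ∎))
  where open ≤-Reasoning
lucas₃ (suc m) zero r s r<3 s<3 = begin
  ((r + 3 * suc m) C (s + 0)) % 3 ≡⟨ cong₂ (λ a b → (a C b) % 3) (r+3[1+m]≡3+[r+3m] r m) (+-identityʳ s) ⟩
  ((3 + n) C s) % 3               ≡⟨ [3+n]Cs≡nCs[mod3] n s s<3 ⟩
  (n C s) % 3                     ≡⟨ cong (λ b → (n C b) % 3) (+-identityʳ s) ⟨
  (n C (s + 0)) % 3               ≡⟨ lucas₃ m zero r s r<3 s<3 ⟩
  ((m C 0) * (r C s)) % 3         ∎
  where
  open ≡-Reasoning
  n = r + 3 * m
lucas₃ (suc m) (suc k) r s r<3 s<3 = begin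
  ((r + 3 * suc m) C (s + 3 * suc k)) % 3
    ≡⟨ cong₂ (λ a b → (a C b) % 3) (r+3[1+m]≡3+[r+3m] r m) (r+3[1+m]≡3+[r+3m] s k) ⟩
  ((3 + n) C (3 + j)) % 3
    ≡⟨ [3+n]C[3+k]≡nCk+nC[3+k][mod3] n j ⟩
  (n C j + n C (3 + j)) % 3
    ≡⟨ cong (λ b → (n C j + n C b) % 3) (r+3[1+m]≡3+[r+3m] s k) ⟨
  (n C j + n C (s + 3 * suc k)) % 3
    ≡⟨ %-distribˡ-+ (n C j) (n C (s + 3 * suc k)) 3 ⟩
  ((n C j) % 3 + (n C (s + 3 * suc k)) % 3) % 3
    ≡⟨ cong₂ (λ a b → (a + b) % 3) (lucas₃ m k r s r<3 s<3) (lucas₃ m (suc k) r s r<3 s<3) ⟩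
  (((m C k) * (r C s)) % 3 + ((m C suc k) * (r C s)) % 3) % 3
    ≡⟨ %-distribˡ-+ ((m C k) * (r C s)) ((m C suc k) * (r C s)) 3 ⟨
  ((m C k) * (r C s) + (m C suc k) * (r C s)) % 3
    ≡⟨ cong (_% 3) (*-distribʳ-+ (r C s) (m C k) (m C suc k)) ⟨
  ((m C k + m C suc k) * (r C s)) % 3
    ≡⟨ cong (λ x → (x * (r C s)) % 3) (nCk+nC[k+1]≡[n+1]C[k+1] m k) ⟩
  ((suc m C suc k) * (r C s)) % 3
    ∎
  where
  open ≡-Reasoning
  n = r + 3 * m
  j = s + 3 * k

[r+3m]C[s+3k]≡mCk[mod3] : ∀ m k r s → r < 3 → s < 3 → r C s ≡ 1 →
                           (r + 3 * m) C (s + 3 * k) ≡ m C k [mod 3 ]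
[r+3m]C[s+3k]≡mCk[mod3] m k r s r<3 s<3 rCs≡1 = begin
  ((r + 3 * m) C (s + 3 * k)) % 3 ≡⟨ lucas₃ m k r s r<3 s<3 ⟩
  ((m C k) * (r C s)) % 3         ≡⟨ cong (λ x → ((m C k) * x) % 3) rCs≡1 ⟩
  ((m C k) * 1) % 3               ≡⟨ cong (_% 3) (*-identityʳ (m C k)) ⟩
  (m C k) % 3                     ∎
  where open ≡-Reasoning

[r+3m]C[s+3k]≡0[mod3] : ∀ m k r s → r < s → s < 3 → (r + 3 * m) C (s + 3 * k) ≡ 0 [mod 3 ]
[r+3m]C[s+3k]≡0[mod3] m k r s r<s s<3 = begin
  ((r + 3 * m) C (s + 3 * k)) % 3 ≡⟨ lucas₃ m k r s (<-trans r<s s<3) s<3 ⟩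
  ((m C k) * (r C s)) % 3         ≡⟨ cong (λ x → ((m C k) * x) % 3) (k>n⇒nCk≡0 r<s) ⟩
  ((m C k) * 0) % 3               ≡⟨ cong (_% 3) (*-zeroʳ (m C k)) ⟩
  0                               ∎
  where open ≡-Reasoning

-- Base-3 numerals with the least significant digit on the right (v ·d stands for d + 3v), leading
-- zeros allowed; recursion on them replaces well-founded recursion on n / 3.
infixl 5 _·0 _·1 _·2

data Base3 : ℕ → Set where
  0₃  : Base3 0
  _·0 : ∀ {a} → Base3 a → Base3 (3 * a)
  _·1 : ∀ {a} → Base3 a → Base3 (1 + 3 * a)
  _·2 : ∀ {a} → Base3 a → Base3 (2 + 3 * a)

base3-suc : ∀ {n} → Base3 n → Base3 (suc n)
base3-suc 0₃           = 0₃ ·1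
base3-suc (v ·0)       = v ·1
base3-suc (v ·1)       = v ·2
base3-suc (_·2 {a} v)  = subst Base3 (*-suc 3 a) (base3-suc v ·0)

base3 : ∀ n → Base3 n
base3 zero    = 0₃
base3 (suc n) = base3-suc (base3 n)

[3a]Ca≡0[mod3] : ∀ {a} → Base3 a → 0 < a → (3 * a) C a ≡ 0 [mod 3 ]
[3a]Ca≡0[mod3] 0₃              ()
[3a]Ca≡0[mod3] (_·0 {zero} _)  ()
[3a]Ca≡0[mod3] (_·0 {suc c} v) _ =
  trans ([r+3m]C[s+3k]≡mCk[mod3] (3 * suc c) (suc c) 0 0 z<s z<s refl) ([3a]Ca≡0[mod3] v z<s)
[3a]Ca≡0[mod3] (_·1 {c} _) _ = [r+3m]C[s+3k]≡0[mod3] (1 + 3 * c) c 0 1 z<s (s<s z<s)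
[3a]Ca≡0[mod3] (_·2 {c} _) _ = [r+3m]C[s+3k]≡0[mod3] (2 + 3 * c) c 0 2 z<s (s<s (s<s z<s))

repunit₃ : ℕ → ℕ
repunit₃ zero    = 0
repunit₃ (suc k) = 1 + 3 * repunit₃ k

1+2*repunit₃≡3^k : ∀ k → 1 + 2 * repunit₃ k ≡ 3 ^ k
1+2*repunit₃≡3^k zero    = refl
1+2*repunit₃≡3^k (suc k) = trans (regroup (repunit₃ k)) (cong (3 *_) (1+2*repunit₃≡3^k k))
  where
  regroup : ∀ r → 1 + 2 * (1 + 3 * r) ≡ 3 * (1 + 2 * r)
  regroup = solve-∀

repunit₃≡[3^k∸1]/2 : ∀ k → repunit₃ k ≡ (3 ^ k ∸ 1) / 2
repunit₃≡[3^k∸1]/2 k = begin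
  repunit₃ k                    ≡⟨ m*n/n≡m (repunit₃ k) 2 ⟨
  repunit₃ k * 2 / 2            ≡⟨ cong (_/ 2) (*-comm (repunit₃ k) 2) ⟩
  2 * repunit₃ k / 2            ≡⟨ cong (_/ 2) (m+n∸m≡n 1 (2 * repunit₃ k)) ⟨
  (1 + 2 * repunit₃ k ∸ 1) / 2  ≡⟨ cong (λ x → (x ∸ 1) / 2) (1+2*repunit₃≡3^k k) ⟩
  (3 ^ k ∸ 1) / 2               ∎
  where open ≡-Reasoning

3^k≤repunit₃[1+k] : ∀ k → 3 ^ k ≤ repunit₃ (suc k)
3^k≤repunit₃[1+k] k = begin
  3 ^ k                 ≡⟨ 1+2*repunit₃≡3^k k ⟨
  1 + 2 * repunit₃ k    ≤⟨ +-monoʳ-≤ 1 (*-monoˡ-≤ (repunit₃ k) (n≤1+n 2)) ⟩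
  1 + 3 * repunit₃ k    ∎
  where open ≤-Reasoning

[1+3q]Cq≡1[mod3] : ∀ k → (1 + 3 * repunit₃ k) C repunit₃ k ≡ 1 [mod 3 ]
[1+3q]Cq≡1[mod3] zero    = refl
[1+3q]Cq≡1[mod3] (suc k) =
  trans ([r+3m]C[s+3k]≡mCk[mod3] (repunit₃ (suc k)) (repunit₃ k) 1 1 (s<s z<s) (s<s z<s) refl)
        ([1+3q]Cq≡1[mod3] k)

repunit₃⊎[1+3q]Cq≡0[mod3] : ∀ {q} → Base3 q →
  Σ ℕ (λ k → q ≡ repunit₃ k) ⊎ (1 + 3 * q) C q ≡ 0 [mod 3 ]
repunit₃⊎[1+3q]Cq≡0[mod3] 0₃              = inj₁ (0 , refl)
repunit₃⊎[1+3q]Cq≡0[mod3] (_·0 {zero} _)  = inj₁ (0 , refl)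
repunit₃⊎[1+3q]Cq≡0[mod3] (_·0 {suc a} v) = inj₂
  (trans ([r+3m]C[s+3k]≡mCk[mod3] (3 * suc a) (suc a) 1 0 (s<s z<s) z<s refl) ([3a]Ca≡0[mod3] v z<s))
repunit₃⊎[1+3q]Cq≡0[mod3] (_·1 {a} v) with repunit₃⊎[1+3q]Cq≡0[mod3] v
... | inj₁ (k , refl) = inj₁ (suc k , refl)
... | inj₂ [1+3a]Ca≡0 = inj₂
  (trans ([r+3m]C[s+3k]≡mCk[mod3] (1 + 3 * a) a 1 1 (s<s z<s) (s<s z<s) refl) [1+3a]Ca≡0)
repunit₃⊎[1+3q]Cq≡0[mod3] (_·2 {a} _) =
  inj₂ ([r+3m]C[s+3k]≡0[mod3] (2 + 3 * a) a 1 2 (s<s z<s) (s<s (s<s z<s)))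

[3[1+3q]]C[3q]≡[1+3q]Cq[mod3] : ∀ q → (3 * suc (3 * q)) C (3 * q) ≡ (1 + 3 * q) C q [mod 3 ]
[3[1+3q]]C[3q]≡[1+3q]Cq[mod3] q = [r+3m]C[s+3k]≡mCk[mod3] (1 + 3 * q) q 0 0 z<s z<s refl

[3[1+j]]Cj≢0[mod3]⇒1+j≡repunit₃ : ∀ j → ¬ (3 * suc j) C j ≡ 0 [mod 3 ] →
  Σ ℕ λ k → suc j ≡ repunit₃ (suc k)
[3[1+j]]Cj≢0[mod3]⇒1+j≡repunit₃ j ≢0 with base3 j
... | 0₃ = 0 , refl
... | _·0 {q} v with repunit₃⊎[1+3q]Cq≡0[mod3] v
...   | inj₁ (k , refl) = k , refl
...   | inj₂ ≡0 = contradiction (trans ([3[1+3q]]C[3q]≡[1+3q]Cq[mod3] q) ≡0) ≢0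
[3[1+j]]Cj≢0[mod3]⇒1+j≡repunit₃ j ≢0 | _·1 {q} _ =
  contradiction ([r+3m]C[s+3k]≡0[mod3] (suc j) q 0 1 z<s (s<s z<s)) ≢0
[3[1+j]]Cj≢0[mod3]⇒1+j≡repunit₃ j ≢0 | _·2 {q} _ =
  contradiction ([r+3m]C[s+3k]≡0[mod3] (suc j) q 0 2 z<s (s<s (s<s z<s))) ≢0

[3repunit₃[1+k]]C[3repunit₃k]≢0[mod3] : ∀ k →
  ¬ (3 * repunit₃ (suc k)) C (3 * repunit₃ k) ≡ 0 [mod 3 ]
[3repunit₃[1+k]]C[3repunit₃k]≢0[mod3] k ≡0 with
  trans (sym ([1+3q]Cq≡1[mod3] k)) (trans (sym ([3[1+3q]]C[3q]≡[1+3q]Cq[mod3] (repunit₃ k))) ≡0)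
... | ()

theorem3 : (n i : ℕ) → 1 ≤ n → 1 ≤ i → i < 3 ^ n →
    (¬ ((3 * i) C (i ∸ 1)) % 3 ≡ 0)
      ⇔ Σ ℕ (λ k → (1 ≤ k × k ≤ n) × i ≡ (3 ^ k ∸ 1) / 2)
theorem3 _ zero    _ () _
theorem3 n (suc j) _ _  i<3ⁿ = mk⇔ to from
  where
  to : ¬ ((3 * suc j) C j) % 3 ≡ 0 → Σ ℕ (λ k → (1 ≤ k × k ≤ n) × suc j ≡ (3 ^ k ∸ 1) / 2)
  to ≢0 with [3[1+j]]Cj≢0[mod3]⇒1+j≡repunit₃ j ≢0
  ... | k , i≡repunit = suc k , (s≤s z≤n , k<n) , trans i≡repunit (repunit₃≡[3^k∸1]/2 (suc k))
    where
    k<n : k < n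
    k<n = ^-cancelʳ-< 3 (≤-<-trans (≤-trans (3^k≤repunit₃[1+k] k) (≤-reflexive (sym i≡repunit))) i<3ⁿ)
  from : Σ ℕ (λ k → (1 ≤ k × k ≤ n) × suc j ≡ (3 ^ k ∸ 1) / 2) → ¬ ((3 * suc j) C j) % 3 ≡ 0
  from (zero  , (() , _) , _)
  from (suc k , _ , i≡[3ᵏ∸1]/2)
    with suc-injective (trans i≡[3ᵏ∸1]/2 (sym (repunit₃≡[3^k∸1]/2 (suc k))))
  ... | refl = [3repunit₃[1+k]]C[3repunit₃k]≢0[mod3] k
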